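{- Let $n\ge 1$ and let $P=(r_0,r_1,\dots,r_{2^n-1})$ be an $n$-bit permutation all of whose row numbers are at normal positions, i.e. $r_x\equiv x \pmod 2$ for every $x\in\{0,\dots,2^n-1\}$. Let $l$ be an integer with $0\le l\le 2^{n-1}-1$ such that $P$ has blocks at each of the block-wise positions $0,1,\dots,l-1$, i.e. $r_{2t+1}=r_{2t}+1$ for all $0\le t\le l-1$. Define $h_n:\mathbb{N}\to\mathbb{Z}$ by $h_n(x)=2^n-2^{n-(x-1)}$, and let $m$ be the smallest positive integer satisfying $$2l\le \sum_{j=1}^{m-1}2^{n-j}\qquad(\text{the empty sum is }0,\text{ so }m=1\text{ when }l=0).$$ Then there exists at least one relevant row pair $\langle 2j,2j+1\rangle$ ($0\le j\le 2^{n-1}-1$) such that, if $\alpha$ and $\beta$ denote the column numbers with $r_\alpha=2j$ and $r_\beta=2j+1$, we have $$h_n(m)\le \min(\alpha,\beta).$$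
   Context: An $n$-bit permutation is a bijection of $\{0,1,\dots,2^n-1\}$ written in one-line notation $P=(r_0,r_1,\dots,r_{2^n-1})$; the index $x$ is called the column number and $r_x$ the row number at column $x$. A relevant row pair is a pair of row numbers $\langle 2j,2j+1\rangle$ with $0\le j\le 2^{n-1}-1$. For $0\le t\le 2^{n-1}-1$, the block-wise position $t$ consists of the two columns $2t,2t+1$, and $P$ has a block at block-wise position $t$ if $r_{2t+1}=r_{2t}+1$ (when all row numbers are at normal positions this means that a relevant row pair occupies columns $2t,2t+1$). Note that $\sum_{j=1}^{m-1}2^{n-j}=h_n(m)$. -}

module Defs where

open import Data.Nat using (ℕ; zero; suc; _+_; _*_; _∸_; _^_; _≤_; _<_; _%_)
open import Data.Integer as ℤ using (ℤ; +_)
open import Data.Fin using (Fin; toℕ)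
open import Data.Fin.Permutation using (Permutation′; _⟨$⟩ʳ_)
open import Relation.Binary.PropositionalEquality using (_≡_)

-- row number r_x of the permutation P at column x, as a natural number
row : ∀ {N} → Permutation′ N → Fin N → ℕ
row P x = toℕ (P ⟨$⟩ʳ x)

AllNormal : ∀ {N} → Permutation′ N → Set
AllNormal P = ∀ x → row P x % 2 ≡ toℕ x % 2

HasBlockAt : ∀ {N} → Permutation′ N → ℕ → Set
HasBlockAt P t = ∀ x y → toℕ x ≡ 2 * t → toℕ y ≡ suc (2 * t) → row P y ≡ suc (row P x)

-- S n k = Σ_{j=1}^{k} 2^{n-j}  (only used with k ≤ n, where ∸ is exact)
S : ℕ → ℕ → ℕ
S n zero = 0
S n (suc k) = S n k + 2 ^ (n ∸ suc k)

-- h_n(x) = 2^n - 2^{n-(x-1)}  (in ℤ; used for 1 ≤ x ≤ n+1)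
h : ℕ → ℕ → ℤ
h n x = (+ (2 ^ n)) ℤ.- (+ (2 ^ (n ∸ (x ∸ 1))))

-- Put H = h_n(m) = Σ_{j=1}^{m-1} 2^{n-j}; minimality of m gives 2l ≤ H < 2^{n-1} + l.
-- If every relevant row pair had a column below H, the smaller of its two columns
-- would give 2^{n-1} distinct columns below H.  None of them is one of the l odd
-- columns 2t+1 (t < l), which are below H as well: by normality such a column holds
-- an odd row 2j+1, and the block at t puts the row 2j in the still smaller column 2t.
-- That is 2^{n-1} + l distinct columns below H, a contradiction.
module Submission where

open import Defs
open import Data.Nat using (ℕ; zero; suc; _+_; _*_; _∸_; _^_; _≤_; _<_; _⊓_; _%_; ⌊_/2⌋; z≤n; s≤s; s<s⁻¹; _≤?_)
open import Data.Nat.Properties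
open import Data.Nat.DivMod using ([m+kn]%n≡m%n; m*n%n≡0)
open import Data.Nat.Tactic.RingSolver using (solve-∀)
open import Data.Integer as ℤ using (+_; +≤+)
import Data.Integer.Properties as ℤ
open import Data.Fin using (Fin; toℕ; fromℕ<; splitAt; join)
open import Data.Fin.Properties using (toℕ-fromℕ<; toℕ-injective; toℕ<n; injective⇒≤; join-splitAt; any?)
open import Data.Fin.Permutation using (Permutation′; _⟨$⟩ˡ_; inverseˡ; inverseʳ)
open import Data.Sum using (_⊎_; inj₁; inj₂)
open import Data.Product using (Σ; _×_; _,_; ∃-syntax)
open import Data.Empty using (⊥-elim)
open import Function using (_∘_)
open import Function.Definitions using (Injective)
open import Relation.Nullary using (¬_; yes; no)
open import Relation.Binary.PropositionalEquality
  using (_≡_; _≢_; refl; sym; trans; cong; cong₂; subst; subst₂; module ≡-Reasoning)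

odd<double : ∀ {a b} → a < b → suc (2 * a) < 2 * b
odd<double {a} {b} a<b = subst (_≤ 2 * b) (cong suc (+-suc a (a + 0))) (*-monoʳ-≤ 2 a<b)

even%2≢odd%2 : ∀ a b → (2 * a) % 2 ≢ suc (2 * b) % 2
even%2≢odd%2 a b eq with trans (sym (m*n%n≡0 a 2)) (trans (cong (_% 2) (*-comm a 2)) (trans eq
                        (trans (cong (λ x → suc x % 2) (*-comm 2 b)) ([m+kn]%n≡m%n 1 b 2))))
... | ()

⌊2*n/2⌋≡n : ∀ n → ⌊ 2 * n /2⌋ ≡ n
⌊2*n/2⌋≡n n = sym (trans (n≡⌊n+n/2⌋ n) (cong (λ x → ⌊ n + x /2⌋) (sym (+-identityʳ n))))

⌊1+2*n/2⌋≡n : ∀ n → ⌊ suc (2 * n) /2⌋ ≡ n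
⌊1+2*n/2⌋≡n n = sym (trans (n≡⌈n+n/2⌉ n) (cong (λ x → ⌊ suc (n + x) /2⌋) (sym (+-identityʳ n))))

injective-below⇒≤ : ∀ {k H} (f : Fin k → ℕ) → (∀ i → f i < H) → Injective _≡_ _≡_ f → k ≤ H
injective-below⇒≤ f f<H f-injective = injective⇒≤ {f = λ i → fromℕ< (f<H i)}
  (λ eq → f-injective (trans (sym (toℕ-fromℕ< _)) (trans (cong toℕ eq) (toℕ-fromℕ< _))))

⊎-injective-below⇒≤ : ∀ {a b H} (f : Fin a ⊎ Fin b → ℕ) → (∀ i → f i < H) → Injective _≡_ _≡_ f →
  a + b ≤ H
⊎-injective-below⇒≤ {a} {b} f f<H f-injective =
  injective-below⇒≤ (f ∘ splitAt a) (f<H ∘ splitAt a) λ {i} {i′} eq →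
    trans (sym (join-splitAt a b i)) (trans (cong (join a b) (f-injective eq)) (join-splitAt a b i′))

2^[n∸k]≡2*2^[n∸[1+k]] : ∀ {n k} → suc k ≤ n → 2 ^ (n ∸ k) ≡ 2 * 2 ^ (n ∸ suc k)
2^[n∸k]≡2*2^[n∸[1+k]] {suc n} (s≤s k≤n) = cong (2 ^_) (+-∸-assoc 1 k≤n)

S+2^[n∸k]≡2^n : ∀ n k → k ≤ n → S n k + 2 ^ (n ∸ k) ≡ 2 ^ n
S+2^[n∸k]≡2^n n zero _ = refl
S+2^[n∸k]≡2^n n (suc k) 1+k≤n = begin
  S n k + q + q        ≡⟨ +-assoc (S n k) q q ⟩
  S n k + (q + q)      ≡⟨ cong (λ x → S n k + (q + x)) (sym (+-identityʳ q)) ⟩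
  S n k + 2 * q        ≡⟨ cong (λ x → S n k + x) (sym (2^[n∸k]≡2*2^[n∸[1+k]] 1+k≤n)) ⟩
  S n k + 2 ^ (n ∸ k)  ≡⟨ S+2^[n∸k]≡2^n n k (≤-trans (n≤1+n k) 1+k≤n) ⟩
  2 ^ n                ∎
  where
  open ≡-Reasoning
  q : ℕ
  q = 2 ^ (n ∸ suc k)

S-double : ∀ n k → suc k ≤ n → 2 * S n (suc k) ≡ S n k + 2 ^ n
S-double n k 1+k≤n = begin
  2 * (S n k + q)            ≡⟨ regroup (S n k) q ⟩
  S n k + (S n k + 2 * q)    ≡⟨ cong (λ x → S n k + (S n k + x)) (sym (2^[n∸k]≡2*2^[n∸[1+k]] 1+k≤n)) ⟩
  S n k + (S n k + 2 ^ (n ∸ k)) ≡⟨ cong (λ x → S n k + x) (S+2^[n∸k]≡2^n n k (≤-trans (n≤1+n k) 1+k≤n)) ⟩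
  S n k + 2 ^ n              ∎
  where
  open ≡-Reasoning
  q : ℕ
  q = 2 ^ (n ∸ suc k)
  regroup : ∀ a b → 2 * (a + b) ≡ a + (a + 2 * b)
  regroup = solve-∀

S-mono-≤ : ∀ n {k k′} → k ≤ k′ → S n k ≤ S n k′
S-mono-≤ n {k′ = zero} z≤n = ≤-refl
S-mono-≤ n {k′ = suc k′} k≤1+k′ with m≤n⇒m<n∨m≡n k≤1+k′
... | inj₁ (s≤s k≤k′) = ≤-trans (S-mono-≤ n k≤k′) (m≤m+n _ _)
... | inj₂ refl = ≤-refl

S-cancel-< : ∀ n {k k′} → S n k < S n k′ → k < k′
S-cancel-< n S<S = ≰⇒> (λ k′≤k → <⇒≱ S<S (S-mono-≤ n k′≤k))

h≡S : ∀ n k → k ≤ n → h n (suc k) ≡ + S n k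
h≡S n k k≤n = begin
  (+ (2 ^ n)) ℤ.- (+ (2 ^ (n ∸ k)))  ≡⟨ ℤ.[+m]-[+n]≡m⊖n (2 ^ n) (2 ^ (n ∸ k)) ⟩
  2 ^ n ℤ.⊖ 2 ^ (n ∸ k)      ≡⟨ ℤ.⊖-≥ (^-monoʳ-≤ 2 (m∸n≤m n k)) ⟩
  + (2 ^ n ∸ 2 ^ (n ∸ k))    ≡⟨ cong (λ x → + (x ∸ 2 ^ (n ∸ k))) (sym (S+2^[n∸k]≡2^n n k k≤n)) ⟩
  + (S n k + 2 ^ (n ∸ k) ∸ 2 ^ (n ∸ k)) ≡⟨ cong +_ (m+n∸n≡m (S n k) (2 ^ (n ∸ k))) ⟩
  + S n k                    ∎
  where open ≡-Reasoning

threshold-bounds : ∀ {n l} k → l < 2 ^ n →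
  (∀ m′ → 1 ≤ m′ → m′ < suc k → ¬ (2 * l ≤ S (suc n) (m′ ∸ 1))) →
  k ≤ suc n × S (suc n) k < 2 ^ n + l
threshold-bounds {n} zero _ _ = z≤n , ≤-trans (m^n>0 2 n) (m≤m+n _ _)
threshold-bounds {n} {l} (suc k) l<2^n minimal = k<1+n , S<2^n+l
  where
  below : S (suc n) k < 2 * l
  below = ≰⇒> (minimal (suc k) (s≤s z≤n) ≤-refl)
  open ≤-Reasoning
  2l<S[1+n][1+n] : 2 * l < S (suc n) (suc n)
  2l<S[1+n][1+n] = s<s⁻¹ (begin-strict
    suc (2 * l)                  <⟨ odd<double l<2^n ⟩
    2 ^ suc n                    ≡⟨ sym (S+2^[n∸k]≡2^n (suc n) (suc n) ≤-refl) ⟩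
    S (suc n) (suc n) + 2 ^ (suc n ∸ suc n) ≡⟨ cong (λ x → S (suc n) (suc n) + 2 ^ x) (n∸n≡0 n) ⟩
    S (suc n) (suc n) + 1        ≡⟨ +-comm _ 1 ⟩
    suc (S (suc n) (suc n))      ∎)
  k<1+n : suc k ≤ suc n
  k<1+n = S-cancel-< (suc n) (<-trans below 2l<S[1+n][1+n])
  S<2^n+l : S (suc n) (suc k) < 2 ^ n + l
  S<2^n+l = *-cancelˡ-< 2 _ _ (begin-strict
    2 * S (suc n) (suc k)        ≡⟨ S-double (suc n) k k<1+n ⟩
    S (suc n) k + 2 * 2 ^ n      <⟨ +-monoˡ-< _ below ⟩
    2 * l + 2 * 2 ^ n            ≡⟨ sym (*-distribˡ-+ 2 l (2 ^ n)) ⟩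
    2 * (l + 2 ^ n)              ≡⟨ cong (2 *_) (+-comm l (2 ^ n)) ⟩
    2 * (2 ^ n + l)              ∎)

module RowPairs {M : ℕ} (P : Permutation′ (2 * M)) where

  col : Fin (2 * M) → Fin (2 * M)
  col r = P ⟨$⟩ˡ r

  row-col : ∀ r → row P (col r) ≡ toℕ r
  row-col r = cong toℕ (inverseʳ P)

  col-unique : ∀ {α r} → row P α ≡ toℕ r → α ≡ col r
  col-unique r≡ = trans (sym (inverseˡ P)) (cong col (toℕ-injective r≡))

  evenRow oddRow : Fin M → Fin (2 * M)
  evenRow j = fromℕ< (<-trans (n<1+n _) (odd<double (toℕ<n j)))
  oddRow j = fromℕ< (odd<double (toℕ<n j))

  evenCol oddCol lowCol : Fin M → ℕ
  evenCol j = toℕ (col (evenRow j))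
  oddCol j = toℕ (col (oddRow j))
  lowCol j = evenCol j ⊓ oddCol j

  row-evenCol : ∀ j → row P (col (evenRow j)) ≡ 2 * toℕ j
  row-evenCol j = trans (row-col _) (toℕ-fromℕ< _)

  row-oddCol : ∀ j → row P (col (oddRow j)) ≡ suc (2 * toℕ j)
  row-oddCol j = trans (row-col _) (toℕ-fromℕ< _)

  lowCol-spec : ∀ j {α β} → row P α ≡ 2 * toℕ j → row P β ≡ suc (2 * toℕ j) →
    toℕ α ⊓ toℕ β ≡ lowCol j
  lowCol-spec j rα rβ = cong₂ (λ α β → toℕ α ⊓ toℕ β)
    (col-unique (trans rα (sym (toℕ-fromℕ< _)))) (col-unique (trans rβ (sym (toℕ-fromℕ< _))))

  lowCol-row : ∀ j → ∃[ c ] toℕ c ≡ lowCol j × ⌊ row P c /2⌋ ≡ toℕ j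
  lowCol-row j with ⊓-sel (evenCol j) (oddCol j)
  ... | inj₁ low≡even = col (evenRow j) , sym low≡even , trans (cong ⌊_/2⌋ (row-evenCol j)) (⌊2*n/2⌋≡n _)
  ... | inj₂ low≡odd = col (oddRow j) , sym low≡odd , trans (cong ⌊_/2⌋ (row-oddCol j)) (⌊1+2*n/2⌋≡n _)

  lowCol-injective : Injective _≡_ _≡_ lowCol
  lowCol-injective {j} {j′} eq with lowCol-row j | lowCol-row j′
  ... | c , c≡ , half | c′ , c′≡ , half′ = toℕ-injective (begin
    toℕ j              ≡⟨ sym half ⟩
    ⌊ row P c /2⌋      ≡⟨ cong (⌊_/2⌋ ∘ row P) (toℕ-injective (trans c≡ (trans eq (sym c′≡)))) ⟩
    ⌊ row P c′ /2⌋     ≡⟨ half′ ⟩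
    toℕ j′             ∎)
    where open ≡-Reasoning

  module _ (normal : AllNormal P) {l : ℕ} (blocks : ∀ t → t < l → HasBlockAt P t) where

    lowCol≢blockOdd : ∀ j {t} → t < l → lowCol j ≢ suc (2 * t)
    lowCol≢blockOdd j {t} t<l eq with ⊓-sel (evenCol j) (oddCol j)
    ... | inj₁ low≡even = even%2≢odd%2 (toℕ j) t (begin
      2 * toℕ j % 2                 ≡⟨ cong (_% 2) (sym (row-evenCol j)) ⟩
      row P (col (evenRow j)) % 2   ≡⟨ normal (col (evenRow j)) ⟩
      evenCol j % 2                 ≡⟨ cong (_% 2) (trans (sym low≡even) eq) ⟩
      suc (2 * t) % 2               ∎)
      where open ≡-Reasoning
    ... | inj₂ low≡odd = 1+n≰n (subst₂ _≤_ eq evenCol≡2t (m⊓n≤m (evenCol j) (oddCol j)))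
      where
      oddCol≡ : oddCol j ≡ suc (2 * t)
      oddCol≡ = trans (sym low≡odd) eq
      2t : Fin (2 * M)
      2t = fromℕ< (<-trans (n<1+n _) (subst (_< 2 * M) oddCol≡ (toℕ<n (col (oddRow j)))))
      2t≡ : toℕ 2t ≡ 2 * t
      2t≡ = toℕ-fromℕ< _
      row-2t : row P 2t ≡ 2 * toℕ j
      row-2t = suc-injective (trans (sym (blocks t t<l 2t (col (oddRow j)) 2t≡ oddCol≡)) (row-oddCol j))
      evenCol≡2t : evenCol j ≡ 2 * t
      evenCol≡2t = trans (cong toℕ (sym (col-unique (trans row-2t (sym (toℕ-fromℕ< _)))))) 2t≡

    pair-above : ∀ H → 2 * l ≤ H → H < M + l →
      Σ ℕ (λ j → j < M ×
        (∀ α β → row P α ≡ 2 * j → row P β ≡ suc (2 * j) → H ≤ toℕ α ⊓ toℕ β))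
    pair-above H 2l≤H H<M+l with any? (λ j → H ≤? lowCol j)
    ... | yes (j , H≤low) = toℕ j , toℕ<n j , λ α β rα rβ → subst (H ≤_) (sym (lowCol-spec j rα rβ)) H≤low
    ... | no none = ⊥-elim (<⇒≱ H<M+l (⊎-injective-below⇒≤ F F<H F-injective))
      where
      F : Fin M ⊎ Fin l → ℕ
      F (inj₁ j) = lowCol j
      F (inj₂ t) = suc (2 * toℕ t)

      F<H : ∀ i → F i < H
      F<H (inj₁ j) = ≰⇒> (λ H≤low → none (j , H≤low))
      F<H (inj₂ t) = ≤-trans (odd<double (toℕ<n t)) 2l≤H

      F-injective : Injective _≡_ _≡_ F
      F-injective {inj₁ j} {inj₁ j′} eq = cong inj₁ (lowCol-injective eq)
      F-injective {inj₁ j} {inj₂ t} eq = ⊥-elim (lowCol≢blockOdd j (toℕ<n t) eq)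
      F-injective {inj₂ t} {inj₁ j} eq = ⊥-elim (lowCol≢blockOdd j (toℕ<n t) (sym eq))
      F-injective {inj₂ t} {inj₂ t′} eq = cong inj₂ (toℕ-injective (*-cancelˡ-≡ _ _ 2 (suc-injective eq)))

proposition1 : (n : ℕ) → 1 ≤ n → (P : Permutation′ (2 ^ n)) → AllNormal P →
    (l : ℕ) → l < 2 ^ (n ∸ 1) → (∀ t → t < l → HasBlockAt P t) →
    (m : ℕ) → 1 ≤ m → 2 * l ≤ S n (m ∸ 1) →
    (∀ m′ → 1 ≤ m′ → m′ < m → ¬ (2 * l ≤ S n (m′ ∸ 1))) →
    Σ ℕ (λ j → j < 2 ^ (n ∸ 1) ×
      (∀ (α β : Fin (2 ^ n)) → row P α ≡ 2 * j → row P β ≡ suc (2 * j) →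
        h n m ℤ.≤ + (toℕ α ⊓ toℕ β)))
proposition1 (suc n) _ P normal l l<2^n blocks (suc k) _ 2l≤S minimal
  with threshold-bounds k l<2^n minimal
... | k≤1+n , S<2^n+l with RowPairs.pair-above P normal blocks (S (suc n) k) 2l≤S S<2^n+l
... | j , j<2^n , above = j , j<2^n , λ α β rα rβ →
  ℤ.≤-trans (ℤ.≤-reflexive (h≡S (suc n) k k≤1+n)) (+≤+ (above α β rα rβ))
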